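{- Let $G=(V,E)$ be an undirected graph with positive edge weights $c:E\to\mathbb{R}_{+}$, let $t\ge 1$, and let $T_\ell\subseteq T_{\ell-1}\subseteq\cdots\subseteq T_1\subseteq V$ be nested terminal sets. Let $H$ be a minimum-cost subsetwise $(T_1\times T_1)$-spanner of $G$ with stretch factor $t$. The oracle bottom-up algorithm outputs $G_1=H$ and subgraphs $G_\ell\subseteq G_{\ell-1}\subseteq\cdots\subseteq G_2\subseteq H$, obtained from $H$ either by copying $H$ to every level ($G_i=H$ for all $i$) or by pruning edges of $H$ not needed on higher levels, in such a way that each $G_i$ is a subsetwise $(T_i\times T_i)$-spanner of $G$ with stretch factor $t$. Let $\mathrm{BOT}=\sum_{i=1}^{\ell}\sum_{e\in E(G_i)}c_e$ be the cost of this output and let $\mathrm{OPT}$ be the cost of an optimal solution of the multi-level graph spanner problem on this instance. Then $\mathrm{BOT}\le \ell\cdot\mathrm{OPT}$.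
   Context: For a weighted graph $G$, $d_G(u,v)$ denotes the length of a shortest $u$–$v$ path in $G$ with respect to $c$. Given $S\subseteq V$ and $t\ge1$, a subgraph $H$ of $G$ is a subsetwise $(S\times S)$-spanner of $G$ with stretch factor $t$ if $d_H(u,v)\le t\cdot d_G(u,v)$ for all $u,v\in S$; its cost is the sum of the weights of its edges. The multi-level graph spanner (MLGS) problem: given $G$, $c$, nested terminals $T_\ell\subseteq\cdots\subseteq T_1\subseteq V$ and $t\ge1$, find subgraphs $G_\ell\subseteq G_{\ell-1}\subseteq\cdots\subseteq G_1$ of $G$ such that each $G_i$ is a subsetwise $(T_i\times T_i)$-spanner of $G$ with stretch factor $t$, minimizing the cost $\sum_{i=1}^{\ell}\sum_{e\in E(G_i)}c_e$.
   Formalization: The edge weights and the stretch factor t are rational instead of real. -}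

module Defs where

open import Data.Nat using (ℕ; zero; suc)
open import Data.Fin using (Fin; zero; suc; toℕ)
import Data.Nat as ℕ
open import Data.Fin.Subset using (Subset; _∈_; _⊆_)
open import Data.Vec using (lookup)
open import Data.Bool using (true; false)
open import Data.Product using (_×_; _,_; proj₁; proj₂; ∃; ∃-syntax)
open import Data.Sum using (_⊎_)
open import Relation.Binary.PropositionalEquality using (_≡_; _≢_)
open import Relation.Nullary using (¬_)
open import Data.Integer using (+_)
open import Data.Rational using (ℚ; 0ℚ; 1ℚ; _+_; _*_; _≤_; Positive; _/_)

-- An undirected edge-weighted graph on vertex set Fin n with m edges.
-- Edge e has endpoints ends e (order irrelevant) and weight weight e.
record WGraph : Set where
  field
    n      : ℕ
    m      : ℕ
    ends   : Fin m → Fin n × Fin n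
    weight : Fin m → ℚ

open WGraph public

Simple : WGraph → Set
Simple G =
  (∀ e → proj₁ (ends G e) ≢ proj₂ (ends G e)) ×
  (∀ e f → (ends G e ≡ ends G f ⊎
             (proj₁ (ends G e) ≡ proj₂ (ends G f) × proj₂ (ends G e) ≡ proj₁ (ends G f)))
         → e ≡ f)

PositiveWeights : WGraph → Set
PositiveWeights G = ∀ e → Positive (weight G e)

-- Subgraphs of G are given by their edge sets (vertex set irrelevant for spanners).
SubG : WGraph → Set
SubG G = Subset (m G)

Joins : (G : WGraph) → Fin (m G) → Fin (n G) → Fin (n G) → Set
Joins G e u w = ends G e ≡ (u , w) ⊎ ends G e ≡ (w , u)

data Walk (G : WGraph) (H : SubG G) : Fin (n G) → Fin (n G) → Set where
  [] : ∀ {u} → Walk G H u u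
  step : ∀ {u w v} (e : Fin (m G)) → e ∈ H → Joins G e u w → Walk G H w v → Walk G H u v

len : ∀ {G H u v} → Walk G H u v → ℚ
len [] = 0ℚ
len {G} (step e _ _ p) = weight G e + len p

full : (G : WGraph) → SubG G
full G = Data.Fin.Subset.⊤

IsDist : (G : WGraph) → SubG G → Fin (n G) → Fin (n G) → ℚ → Set
IsDist G H u v δ =
  (∃[ p ] len {G} {H} {u} {v} p ≡ δ) × (∀ (p : Walk G H u v) → δ ≤ len p)

-- H is a subsetwise (S×S)-spanner of G with stretch factor t:
-- d_H(u,v) ≤ t·d_G(u,v) for all u,v ∈ S (trivial if u,v disconnected in G).
IsSpanner : (G : WGraph) → Subset (n G) → ℚ → SubG G → Set
IsSpanner G S t H =
  ∀ u v → u ∈ S → v ∈ S → ∀ δ → IsDist G (full G) u v δ →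
    ∃[ δH ] (IsDist G H u v δH × δH ≤ t * δ)

sumFin : ∀ k → (Fin k → ℚ) → ℚ
sumFin zero f = 0ℚ
sumFin (suc k) f = f zero + sumFin k (λ i → f (suc i))

cost : (G : WGraph) → SubG G → ℚ
cost G H = sumFin (m G) (λ e → inc (lookup H e) e)
  where
  inc : Data.Bool.Bool → Fin (m G) → ℚ
  inc true e = weight G e
  inc false e = 0ℚ

IsMinSpanner : (G : WGraph) → Subset (n G) → ℚ → SubG G → Set
IsMinSpanner G S t H =
  IsSpanner G S t H × (∀ H' → IsSpanner G S t H' → cost G H ≤ cost G H')

-- Levels are Fin ℓ; Fin index i stands for level i+1.
-- Nested terminals: T_ℓ ⊆ ... ⊆ T_1.
NestedTerminals : (G : WGraph) (ℓ : ℕ) → (Fin ℓ → Subset (n G)) → Set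
NestedTerminals G ℓ T = ∀ i j → toℕ i ℕ.≤ toℕ j → T j ⊆ T i

Feasible : (G : WGraph) (ℓ : ℕ) → (Fin ℓ → Subset (n G)) → ℚ → (Fin ℓ → SubG G) → Set
Feasible G ℓ T t Gs =
  (∀ i j → toℕ i ℕ.≤ toℕ j → Gs j ⊆ Gs i) ×
  (∀ i → IsSpanner G (T i) t (Gs i))

mlgsCost : (G : WGraph) (ℓ : ℕ) → (Fin ℓ → SubG G) → ℚ
mlgsCost G ℓ Gs = sumFin ℓ (λ i → cost G (Gs i))

IsOptimal : (G : WGraph) (ℓ : ℕ) → (Fin ℓ → Subset (n G)) → ℚ → (Fin ℓ → SubG G) → Set
IsOptimal G ℓ T t Gs =
  Feasible G ℓ T t Gs × (∀ Gs' → Feasible G ℓ T t Gs' → mlgsCost G ℓ Gs ≤ mlgsCost G ℓ Gs')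

ℕtoℚ : ℕ → ℚ
ℕtoℚ k = (+ k) / 1

{-# OPTIONS --safe #-}
module Submission where

-- Every level of the bottom-up solution is a subgraph of H, so BOT ≤ ℓ · c(H). The
-- top level of an optimal solution is a (T₁ × T₁)-spanner, so by minimality of H and
-- nonnegativity of the other levels c(H) ≤ c(OPT₁) ≤ OPT.

open import Defs
open import Data.Bool using (true; false)
open import Data.Fin using (Fin; zero; suc)
open import Data.Fin.Subset using (Subset; _⊆_)
open import Data.Integer using (+_)
import Data.Integer as ℤ
import Data.Integer.Properties as ℤ
open import Data.Nat using (ℕ; suc)
open import Data.Nat.Coprimality using (1-coprimeTo) renaming (sym to coprime-sym)
open import Data.Product using (_,_)
open import Data.Rational using (ℚ; 0ℚ; 1ℚ; _+_; _*_; _/_; _≤_; NonNegative)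
open import Data.Rational.Properties
open import Data.Vec using (lookup)
open import Data.Vec.Properties using ([]=⇒lookup; lookup⇒[]=)
open import Function using (_∘_)
open import Relation.Binary.PropositionalEquality using (_≡_; sym; trans; cong; subst; module ≡-Reasoning)
open import Relation.Nullary using (contradiction)

ℕtoℚ-suc : ∀ k → 1ℚ + ℕtoℚ k ≡ ℕtoℚ (suc k)
ℕtoℚ-suc k = begin
  1ℚ + ℕtoℚ k                ≡⟨ cong (λ q → 1ℚ + q) (normalize-coprime (coprime-sym (1-coprimeTo k))) ⟩
  (+ 1 ℤ.+ + k ℤ.* + 1) / 1  ≡⟨ cong (λ z → (+ 1 ℤ.+ z) / 1) (ℤ.*-identityʳ (+ k)) ⟩
  ℕtoℚ (suc k)               ∎
  where open ≡-Reasoning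

sumFin-const : ∀ k c → sumFin k (λ _ → c) ≡ ℕtoℚ k * c
sumFin-const ℕ.zero c = sym (*-zeroˡ c)
sumFin-const (suc k) c = begin
  c + sumFin k (λ _ → c)   ≡⟨ cong (λ q → c + q) (sumFin-const k c) ⟩
  c + ℕtoℚ k * c           ≡⟨ cong (_+ ℕtoℚ k * c) (sym (*-identityˡ c)) ⟩
  1ℚ * c + ℕtoℚ k * c      ≡⟨ sym (*-distribʳ-+ c 1ℚ (ℕtoℚ k)) ⟩
  (1ℚ + ℕtoℚ k) * c        ≡⟨ cong (_* c) (ℕtoℚ-suc k) ⟩
  ℕtoℚ (suc k) * c         ∎
  where open ≡-Reasoning

sumFin-mono : ∀ k {f g : Fin k → ℚ} → (∀ i → f i ≤ g i) → sumFin k f ≤ sumFin k g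
sumFin-mono ℕ.zero    f≤g = ≤-refl
sumFin-mono (suc k) f≤g = +-mono-≤ (f≤g zero) (sumFin-mono k (λ i → f≤g (suc i)))

sumFin-≤-* : ∀ k {f : Fin k → ℚ} {c : ℚ} → (∀ i → f i ≤ c) → sumFin k f ≤ ℕtoℚ k * c
sumFin-≤-* k {c = c} f≤c = subst (sumFin k _ ≤_) (sumFin-const k c) (sumFin-mono k f≤c)

sumFin-nonNeg : ∀ k {f : Fin k → ℚ} → (∀ i → 0ℚ ≤ f i) → 0ℚ ≤ sumFin k f
sumFin-nonNeg ℕ.zero    f≥0 = ≤-refl
sumFin-nonNeg (suc k) f≥0 = +-mono-≤ (f≥0 zero) (sumFin-nonNeg k (λ i → f≥0 (suc i)))

head≤sumFin : ∀ k (f : Fin (suc k) → ℚ) → (∀ i → 0ℚ ≤ f (suc i)) → f zero ≤ sumFin (suc k) f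
head≤sumFin k f tail≥0 = subst (_≤ sumFin (suc k) f) (+-identityʳ (f zero))
  (+-monoʳ-≤ (f zero) (sumFin-nonNeg k tail≥0))

module _ {G : WGraph} (weight-nonNeg : ∀ e → 0ℚ ≤ weight G e) where

  -- The summand of cost is local to the where-block of its definition and cannot be
  -- named, so the edgewise facts take their statements from their use in the sums.
  mutual
    cost-mono : ∀ {A B} → A ⊆ B → cost G A ≤ cost G B
    cost-mono {A} {B} A⊆B = sumFin-mono (m G) (edge-cost-mono {A} {B} A⊆B)

    cost-nonNeg : ∀ A → 0ℚ ≤ cost G A
    cost-nonNeg A = sumFin-nonNeg (m G) (edge-cost-nonNeg A)

    edge-cost-mono : ∀ {A B} → A ⊆ B → ∀ e → _
    edge-cost-mono {A} {B} A⊆B e with lookup A e in A[e] | lookup B e in B[e]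
    ... | false | false = ≤-refl
    ... | false | true  = weight-nonNeg e
    ... | true  | true  = ≤-refl
    ... | true  | false =
      contradiction (trans (sym ([]=⇒lookup (A⊆B (lookup⇒[]= e A A[e])))) B[e]) λ ()

    edge-cost-nonNeg : ∀ A e → _
    edge-cost-nonNeg A e with lookup A e
    ... | false = ≤-refl
    ... | true  = weight-nonNeg e

positiveWeights⇒nonNeg : ∀ {G} → PositiveWeights G → ∀ e → 0ℚ ≤ weight G e
positiveWeights⇒nonNeg {G} pos e = <⇒≤ (positive⁻¹ (weight G e) {{pos e}})

theorem1 : (G : WGraph) → Simple G → PositiveWeights G →
    (t : ℚ) → 1ℚ ≤ t →
    (k : ℕ) → (T : Fin (suc k) → Subset (n G)) → NestedTerminals G (suc k) T →
    (H : SubG G) → IsMinSpanner G (T zero) t H →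
    (Gs : Fin (suc k) → SubG G) → Gs zero ≡ H → (∀ i → Gs i ⊆ H) →
    Feasible G (suc k) T t Gs →
    (Opt : Fin (suc k) → SubG G) → IsOptimal G (suc k) T t Opt →
    mlgsCost G (suc k) Gs ≤ ℕtoℚ (suc k) * mlgsCost G (suc k) Opt
theorem1 G _ pos t _ k T _ H (_ , H-minimal) Gs _ Gs⊆H _ Opt ((_ , Opt-spanners) , _) = begin
  mlgsCost G ℓ Gs               ≤⟨ sumFin-≤-* ℓ (λ i → cost-mono {G} w≥0 (Gs⊆H i)) ⟩
  ℕtoℚ ℓ * cost G H             ≤⟨ *-monoˡ-≤-nonNeg (ℕtoℚ ℓ) (H-minimal (Opt zero) (Opt-spanners zero)) ⟩
  ℕtoℚ ℓ * cost G (Opt zero)    ≤⟨ *-monoˡ-≤-nonNeg (ℕtoℚ ℓ) (head≤sumFin k (cost G ∘ Opt) opt-levels≥0) ⟩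
  ℕtoℚ ℓ * mlgsCost G ℓ Opt     ∎
  where
  open ≤-Reasoning
  ℓ : ℕ
  ℓ = suc k
  instance
    ℓ-nonNeg : NonNegative (ℕtoℚ ℓ)
    ℓ-nonNeg = normalize-nonNeg ℓ 1
  w≥0 : ∀ e → 0ℚ ≤ weight G e
  w≥0 = positiveWeights⇒nonNeg {G} pos
  opt-levels≥0 : ∀ i → 0ℚ ≤ cost G (Opt (suc i))
  opt-levels≥0 i = cost-nonNeg {G} w≥0 (Opt (suc i))
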